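{- Let $\lambda$ be a nonzero real number and let $(a_n(\lambda))_{n\ge0}$ be any sequence of real numbers. Define the degenerate B-algorithm matrix $(a_{n,m}(\lambda))_{n,m\ge0}$ by $a_{0,m}(\lambda)=a_m(\lambda)$ for $m\ge0$ and \[ a_{n,m}(\lambda)=\big(m-(n-1)\lambda\big)a_{n-1,m}(\lambda)-(m+1)a_{n-1,m+1}(\lambda),\qquad n\ge1,\ m\ge0. \] For $n\ge0$ let $f_n(t|\lambda)=\sum_{m\ge0}a_{n,m}(\lambda)t^m$ (a formal power series in $t$). Then for every integer $n\ge0$, \[ f_{n}(t|\lambda)=\Big((t-1)\frac{d}{dt}\Big)_{n,\lambda}f_{0}(t|\lambda), \] where for an operator $X$ we write $(X)_{0,\lambda}=\mathrm{id}$ and $(X)_{n,\lambda}=X(X-\lambda)(X-2\lambda)\cdots(X-(n-1)\lambda)$ for $n\ge1$, with $X=(t-1)\frac{d}{dt}$ acting on formal power series in $t$.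
   Context: $\frac{d}{dt}$ denotes formal differentiation of power series, and $(t-1)\frac{d}{dt}$ means differentiate then multiply by $t-1$; the scalar $j\lambda$ in $X-j\lambda$ acts as multiplication by $j\lambda$. -}

module Defs where

open import Data.Nat using (ℕ; zero; suc)
open import Algebra.Bundles using (CommutativeRing)

-- Everything is stated over an arbitrary commutative ring R (ℝ is not
-- available in agda-stdlib); the real case is an instance.
module DegB {c ℓ} (R : CommutativeRing c ℓ) where
  open CommutativeRing R hiding (zero)

  PowerSeries : Set c
  PowerSeries = ℕ → Carrier

  fromℕ : ℕ → Carrier
  fromℕ zero    = 0#
  fromℕ (suc n) = 1# + fromℕ n

  deriv : PowerSeries → PowerSeries
  deriv f m = fromℕ (suc m) * f (suc m)

  mulTminus1 : PowerSeries → PowerSeries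
  mulTminus1 g zero    = - g zero
  mulTminus1 g (suc m) = g m - g (suc m)

  X : PowerSeries → PowerSeries
  X f = mulTminus1 (deriv f)

  XminusJLam : Carrier → ℕ → PowerSeries → PowerSeries
  XminusJLam lam j f m = X f m - (fromℕ j * lam) * f m

  -- (X)_{n,λ} = X (X-λ) ... (X-(n-1)λ) as composition of operators:
  -- (X)_{0,λ} = id,  (X)_{n+1,λ} = (X)_{n,λ} ∘ (X - nλ)
  fallX : Carrier → ℕ → PowerSeries → PowerSeries
  fallX lam zero    f = f
  fallX lam (suc n) f = fallX lam n (XminusJLam lam n f)

  Bmat : Carrier → (ℕ → Carrier) → ℕ → ℕ → Carrier
  Bmat lam a zero    m = a m
  Bmat lam a (suc n) m =
    (fromℕ m - fromℕ n * lam) * Bmat lam a n m - fromℕ (suc m) * Bmat lam a n (suc m)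

  fSeries : Carrier → (ℕ → Carrier) → ℕ → PowerSeries
  fSeries lam a n = Bmat lam a n

{-# OPTIONS --safe #-}

-- Writing Y j = X - jλ, the recursion of the B-algorithm says exactly that
-- a_{n+1,·} = Y n a_{n,·}, so f_n = Y (n-1) (⋯ (Y 0 f_0)).  The falling power
-- (X)_{n,λ} composes the same factors in the opposite order, and the factors
-- commute: X is linear, so (X - c)(X - d) = X² - (c + d) X + c d is
-- symmetric in c and d.
module Submission where

open import Defs
open import Level using (_⊔_)
open import Data.Nat using (ℕ; zero; suc)
open import Relation.Nullary using (¬_)
open import Algebra.Bundles using (CommutativeRing)
import Algebra.Properties.Ring as RingProperties
import Algebra.Properties.CommutativeSemigroup as CommutativeSemigroupProperties
import Relation.Binary.Reasoning.Setoid as SetoidReasoning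

module DegBProperties {c ℓ} (R : CommutativeRing c ℓ) where
  open CommutativeRing R hiding (zero)
  open DegB R
  open SetoidReasoning setoid
  open RingProperties ring using (x[y-z]≈xy-xz; [y-z]x≈yx-zx; -‿+-comm)
  open CommutativeSemigroupProperties +-commutativeSemigroup using (interchange; xy∙z≈xz∙y)
  open CommutativeSemigroupProperties *-commutativeSemigroup using (x∙yz≈y∙xz)

  [x-y]-[z-w]≈[x-z]-[y-w] : ∀ x y z w → (x - y) - (z - w) ≈ (x - z) - (y - w)
  [x-y]-[z-w]≈[x-z]-[y-w] x y z w = begin
    (x - y) - (z - w)     ≈⟨ +-congˡ (-‿+-comm z (- w)) ⟨
    (x - y) + (- z - - w) ≈⟨ interchange x (- y) (- z) (- - w) ⟩
    (x - z) + (- y - - w) ≈⟨ +-congˡ (-‿+-comm y (- w)) ⟩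
    (x - z) - (y - w)     ∎

  x[y-dz]≈xy-d[xz] : ∀ x y d z → x * (y - d * z) ≈ x * y - d * (x * z)
  x[y-dz]≈xy-d[xz] x y d z =
    trans (x[y-z]≈xy-xz x y (d * z)) (+-congˡ (-‿cong (x∙yz≈y∙xz x d z)))

  infix 4 _≋_
  _≋_ : PowerSeries → PowerSeries → Set ℓ
  f ≋ g = ∀ m → f m ≈ g m

  shiftBy : (PowerSeries → PowerSeries) → Carrier → PowerSeries → PowerSeries
  shiftBy T d f m = T f m - d * f m

  Congruent : (PowerSeries → PowerSeries) → Set (c ⊔ ℓ)
  Congruent T = ∀ {f g} → f ≋ g → T f ≋ T g

  Linear : (PowerSeries → PowerSeries) → Set (c ⊔ ℓ)
  Linear T = ∀ d f g → T (λ m → f m - d * g m) ≋ λ m → T f m - d * T g m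

  shiftBy-cong : ∀ {T} → Congruent T → ∀ d → Congruent (shiftBy T d)
  shiftBy-cong T-cong d f≋g m = +-cong (T-cong f≋g m) (-‿cong (*-congˡ (f≋g m)))

  shiftBy-comm : ∀ {T} → Linear T → ∀ d e f →
                 shiftBy T d (shiftBy T e f) ≋ shiftBy T e (shiftBy T d f)
  shiftBy-comm {T} T-linear d e f m = begin
    T (shiftBy T e f) m - d * (T f m - e * f m)
      ≈⟨ +-cong (T-linear e (T f) f m) (-‿cong (x[y-dz]≈xy-d[xz] d (T f m) e (f m))) ⟩
    (T (T f) m - e * T f m) - (d * T f m - e * (d * f m))
      ≈⟨ [x-y]-[z-w]≈[x-z]-[y-w] _ _ _ _ ⟩
    (T (T f) m - d * T f m) - (e * T f m - e * (d * f m))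
      ≈⟨ +-cong (T-linear d (T f) f m) (-‿cong (x[y-z]≈xy-xz e (T f m) (d * f m))) ⟨
    T (shiftBy T d f) m - e * (T f m - d * f m) ∎

  X-coeff : ∀ f m → X f m ≈ fromℕ m * f m - fromℕ (suc m) * f (suc m)
  X-coeff f zero    = sym (trans (+-congʳ (zeroˡ (f zero))) (+-identityˡ _))
  X-coeff f (suc m) = refl

  X-cong : Congruent X
  X-cong {f} {g} f≋g m = begin
    X f m                                     ≈⟨ X-coeff f m ⟩
    fromℕ m * f m - fromℕ (suc m) * f (suc m)
      ≈⟨ +-cong (*-congˡ (f≋g m)) (-‿cong (*-congˡ (f≋g (suc m)))) ⟩
    fromℕ m * g m - fromℕ (suc m) * g (suc m) ≈⟨ X-coeff g m ⟨
    X g m                                     ∎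

  X-linear : Linear X
  X-linear d f g m = begin
    X (λ k → f k - d * g k) m
      ≈⟨ X-coeff (λ k → f k - d * g k) m ⟩
    fromℕ m * (f m - d * g m) - fromℕ (suc m) * (f (suc m) - d * g (suc m))
      ≈⟨ +-cong (x[y-dz]≈xy-d[xz] _ _ _ _) (-‿cong (x[y-dz]≈xy-d[xz] _ _ _ _)) ⟩
    (fromℕ m * f m - d * (fromℕ m * g m))
      - (fromℕ (suc m) * f (suc m) - d * (fromℕ (suc m) * g (suc m)))
      ≈⟨ [x-y]-[z-w]≈[x-z]-[y-w] _ _ _ _ ⟩
    (fromℕ m * f m - fromℕ (suc m) * f (suc m))
      - (d * (fromℕ m * g m) - d * (fromℕ (suc m) * g (suc m)))
      ≈⟨ +-cong (X-coeff f m) (-‿cong (x[y-z]≈xy-xz d _ _)) ⟨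
    X f m - d * (fromℕ m * g m - fromℕ (suc m) * g (suc m))
      ≈⟨ +-congˡ (-‿cong (*-congˡ (X-coeff g m))) ⟨
    X f m - d * X g m ∎

  module _ (lam : Carrier) where

    XminusJLam-comm : ∀ i j f →
      XminusJLam lam i (XminusJLam lam j f) ≋ XminusJLam lam j (XminusJLam lam i f)
    XminusJLam-comm i j = shiftBy-comm X-linear (fromℕ i * lam) (fromℕ j * lam)

    fallX-cong : ∀ n → Congruent (fallX lam n)
    fallX-cong zero    f≋g = f≋g
    fallX-cong (suc n) f≋g = fallX-cong n (shiftBy-cong X-cong (fromℕ n * lam) f≋g)

    fallX-XminusJLam-comm : ∀ n k f →
      fallX lam n (XminusJLam lam k f) ≋ XminusJLam lam k (fallX lam n f)
    fallX-XminusJLam-comm zero    k f m = refl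
    fallX-XminusJLam-comm (suc n) k f m = begin
      fallX lam n (XminusJLam lam n (XminusJLam lam k f)) m
        ≈⟨ fallX-cong n (XminusJLam-comm n k f) m ⟩
      fallX lam n (XminusJLam lam k (XminusJLam lam n f)) m
        ≈⟨ fallX-XminusJLam-comm n k (XminusJLam lam n f) m ⟩
      XminusJLam lam k (fallX lam (suc n) f) m ∎

    Bmat-suc : ∀ a n → Bmat lam a (suc n) ≋ XminusJLam lam n (Bmat lam a n)
    Bmat-suc a n m = begin
      (fromℕ m - fromℕ n * lam) * b₀ - fromℕ (suc m) * b₁
        ≈⟨ +-congʳ ([y-z]x≈yx-zx b₀ (fromℕ m) (fromℕ n * lam)) ⟩
      (fromℕ m * b₀ - fromℕ n * lam * b₀) - fromℕ (suc m) * b₁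
        ≈⟨ xy∙z≈xz∙y _ _ _ ⟩
      (fromℕ m * b₀ - fromℕ (suc m) * b₁) - fromℕ n * lam * b₀
        ≈⟨ +-congʳ (X-coeff (Bmat lam a n) m) ⟨
      XminusJLam lam n (Bmat lam a n) m ∎
      where
      b₀ = Bmat lam a n m
      b₁ = Bmat lam a n (suc m)

    Bmat≋fallX : ∀ a n → Bmat lam a n ≋ fallX lam n a
    Bmat≋fallX a zero    m = refl
    Bmat≋fallX a (suc n) m = begin
      Bmat lam a (suc n) m                 ≈⟨ Bmat-suc a n m ⟩
      XminusJLam lam n (Bmat lam a n) m    ≈⟨ shiftBy-cong X-cong _ (Bmat≋fallX a n) m ⟩
      XminusJLam lam n (fallX lam n a) m   ≈⟨ fallX-XminusJLam-comm n n a m ⟨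
      fallX lam (suc n) a m                ∎

-- The identity holds for every λ.
theorem2p2 : ∀ {c ℓ} (R : CommutativeRing c ℓ) →
    let open CommutativeRing R in let open DegB R in
    (lam : Carrier) → ¬ (lam ≈ 0#) → (a : ℕ → Carrier) →
    ∀ (n m : ℕ) → fSeries lam a n m ≈ fallX lam n (fSeries lam a 0) m
theorem2p2 R lam _ a n = DegBProperties.Bmat≋fallX R lam a n
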